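{- Let $G$ be a connected undirected unweighted multigraph with minimum cut value $\lambda$, and let $H$ be the graph obtained from $G$ by contracting all $3\lambda$-strong components. Then every edge $e$ of $H$ satisfies $\ell^*_H(e)\in\left(\frac{1}{3\lambda},\frac{2}{\lambda}\right)$, where $\ell^*_H$ denotes the ideal loads of $H$.
   Context: A $k$-strong component of a graph is a maximal vertex set whose induced subgraph is $k$-edge-connected; contraction merges each such set into a single vertex, removing self-loops. The ideal loads of a graph are defined by the recursive min-ratio cut process: for a partition $P$ of the vertex set into at least two parts let $\partial P$ be the set of edges between different parts and $d(P)=|\partial P|$; choose $P$ minimizing $d(P)/(|P|-1)$, set the load of every $e\in\partial P$ to $(|P|-1)/d(P)$, and recurse on the induced subgraph of each non-singleton part of $P$ (the resulting loads are known not to depend on the choices made). -}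

module Defs where

open import Data.Nat using (ℕ; zero; suc; _+_; _*_; _∸_; _≤_)
open import Data.Fin using (Fin; _≟_)
open import Data.Bool using (Bool; true; false; _∧_; not; if_then_else_)
open import Data.Product using (_×_; _,_; proj₁; proj₂; Σ; ∃; ∃-syntax; map)
open import Data.Integer using (+_)
open import Data.Rational using (ℚ; _/_)
open import Relation.Nullary using (¬_; Dec; yes; no)
open import Relation.Nullary.Decidable using (⌊_⌋)
open import Relation.Binary.PropositionalEquality using (_≡_; _≢_)
open import Function.Bundles using (_⇔_)

-- A multigraph with vertex set Fin n and edge set Fin m; each edge e has
-- two endpoints (ends e), read as an unordered pair.  Parallel edges are
-- allowed (distinct edge indices with the same endpoints).

Graph : ℕ → ℕ → Set
Graph n m = Fin m → Fin n × Fin n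

VSet : ℕ → Set
VSet n = Fin n → Bool

_∈_ : ∀ {n} → Fin n → VSet n → Set
v ∈ S = S v ≡ true

_⊆_ : ∀ {n} → VSet n → VSet n → Set
S ⊆ T = ∀ v → v ∈ S → v ∈ T

count : ∀ {m} → (Fin m → Bool) → ℕ
count {zero}  P = 0
count {suc m} P = (if P Fin.zero then 1 else 0) + count {m} (λ e → P (Fin.suc e))

inside : ∀ {n m} → Graph n m → VSet n → Fin m → Bool
inside G S e = S (proj₁ (G e)) ∧ S (proj₂ (G e))

_xor_ : Bool → Bool → Bool
true  xor b = not b
false xor b = b

cutIn : ∀ {n m} → Graph n m → VSet n → VSet n → ℕ
cutIn G S A = count (λ e → inside G S e ∧ (A (proj₁ (G e)) xor A (proj₂ (G e))))

allV : ∀ {n} → VSet n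
allV _ = true

data Reach {n m} (G : Graph n m) : Fin n → Fin n → Set where
  here  : ∀ {v} → Reach G v v
  fwd   : ∀ {u v} (e : Fin m) → G e ≡ (u , v) → ∀ {w} → Reach G v w → Reach G u w
  bwd   : ∀ {u v} (e : Fin m) → G e ≡ (v , u) → ∀ {w} → Reach G v w → Reach G u w

Connected : ∀ {n m} → Graph n m → Set
Connected G = ∀ u v → Reach G u v

IsCutSet : ∀ {n} → VSet n → VSet n → Set
IsCutSet S A = A ⊆ S × (∃[ a ] (a ∈ A)) × (∃[ b ] (b ∈ S × A b ≡ false))

IsMinCut : ∀ {n m} → Graph n m → ℕ → Set
IsMinCut G lam =
  (∃[ A ] (IsCutSet allV A × cutIn G allV A ≡ lam)) ×
  (∀ A → IsCutSet allV A → lam ≤ cutIn G allV A)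

KEdgeConnected : ∀ {n m} → Graph n m → ℕ → VSet n → Set
KEdgeConnected G k S = ∀ A → IsCutSet S A → k ≤ cutIn G S A

IsStrongComponent : ∀ {n m} → Graph n m → ℕ → VSet n → Set
IsStrongComponent G k S =
  (∃[ v ] (v ∈ S)) × KEdgeConnected G k S ×
  (∀ T → S ⊆ T → KEdgeConnected G k T → T ⊆ S)

SameComponent : ∀ {n m} → Graph n m → ℕ → Fin n → Fin n → Set
SameComponent G k u v = ∃[ S ] (IsStrongComponent G k S × u ∈ S × v ∈ S)

-- H (with vertex set Fin n' and edge set Fin m') is (isomorphic to) the graph
-- obtained from G by contracting every k-strong component into a single
-- vertex and removing self-loops:
--  * vert maps each vertex of G onto the vertex of H representing its
--    component (surjective; two vertices go to the same vertex of H iff they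
--    lie in a common k-strong component);
--  * edge identifies the edges of H injectively with exactly those edges of G
--    whose endpoints lie in different components, with endpoints mapped by vert.
record IsContraction {n m n' m'} (G : Graph n m) (k : ℕ) (H : Graph n' m') : Set where
  field
    vert       : Fin n → Fin n'
    vert-surj  : ∀ x → ∃[ v ] (vert v ≡ x)
    vert-comp  : ∀ u v → (vert u ≡ vert v) ⇔ SameComponent G k u v
    edge       : Fin m' → Fin m
    edge-inj   : ∀ e₁ e₂ → edge e₁ ≡ edge e₂ → e₁ ≡ e₂
    edge-image : ∀ e → (vert (proj₁ (G e)) ≢ vert (proj₂ (G e))) ⇔ (∃[ e' ] (edge e' ≡ e))
    edge-ends  : ∀ e' → H e' ≡ map vert vert (G (edge e'))

ℕtoℚ : ℕ → ℚ
ℕtoℚ k = (+ k) / 1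

-- p : Fin n → Fin r labels a partition of S into exactly r (nonempty) parts
-- { v ∈ S | p v ≡ i }, i : Fin r.  (Labels of vertices outside S are ignored.)
IsPartition : ∀ {n r} → VSet n → (Fin n → Fin r) → Set
IsPartition {r = r} S p = ∀ (i : Fin r) → ∃[ v ] (v ∈ S × p v ≡ i)

dP : ∀ {n m r} → Graph n m → VSet n → (Fin n → Fin r) → ℕ
dP G S p = count (λ e → inside G S e ∧ not ⌊ p (proj₁ (G e)) ≟ p (proj₂ (G e)) ⌋)

crosses : ∀ {n m r} → Graph n m → VSet n → (Fin n → Fin r) → Fin m → Set
crosses G S p e = (inside G S e ∧ not ⌊ p (proj₁ (G e)) ≟ p (proj₂ (G e)) ⌋) ≡ true

part : ∀ {n r} → VSet n → (Fin n → Fin r) → Fin r → VSet n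
part S p i v = S v ∧ ⌊ p v ≟ i ⌋

Trivial : ∀ {n} → VSet n → Set
Trivial S = ∀ u v → u ∈ S → v ∈ S → u ≡ v

-- P (with r parts) minimises d(P)/(|P|-1) among partitions of S into at
-- least two parts; stated by cross-multiplication in ℕ:
-- d(P)/(r-1) ≤ d(Q)/(r'-1)  ⇔  d(P)(r'-1) ≤ d(Q)(r-1).
MinRatio : ∀ {n m r} → Graph n m → VSet n → (Fin n → Fin r) → Set
MinRatio {n} {r = r} G S p =
  ∀ r' (q : Fin n → Fin r') → 2 ≤ r' → IsPartition S q →
  dP G S p * (r' ∸ 1) ≤ dP G S q * (r ∸ 1)

-- LoadProcess G S ℓ : ℓ is a possible outcome of the recursive min-ratio cut
-- process run on the induced subgraph G[S] (ℓ is constrained exactly on the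
-- edges of G[S] that ever get separated, i.e. all non-loop edges of G[S]).
-- The load (r-1)/d(P) of a crossing edge e is stated as ℓ e · d(P) = r-1
-- (d(P) ≥ 1 whenever a crossing edge exists).
data LoadProcess {n m} (G : Graph n m) : VSet n → (Fin m → ℚ) → Set where
  stop : ∀ {S ℓ} → Trivial S → LoadProcess G S ℓ
  split : ∀ {S ℓ} (r : ℕ) (p : Fin n → Fin r) → 2 ≤ r → IsPartition S p →
          MinRatio G S p →
          (∀ e → crosses G S p e → ℓ e Data.Rational.* ℕtoℚ (dP G S p) ≡ ℕtoℚ (r ∸ 1)) →
          (∀ i → LoadProcess G (part S p i) ℓ) →
          LoadProcess G S ℓ

-- ℓ are the ideal loads of G (the loads do not depend on the choices made)
IdealLoads : ∀ {n m} → Graph n m → (Fin m → ℚ) → Set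
IdealLoads G ℓ = LoadProcess G allV ℓ

-- The min-ratio process only ever splits vertex sets S of H on which every partition Q satisfies
-- d(Q)/(|Q|-1) > λ/2.  For S = V(H) this holds since λ ≥ 1 and each part of Q is the side of a
-- cut of H, hence of G, so the parts have boundaries of size ≥ λ summing to 2 d(Q).  It passes
-- to the parts of a min-ratio partition P of S: refining part i of P by a partition Q of it gives
-- a partition of S whose ratio is the mediant of those of P and Q, so minimality of P forces
-- the ratio of Q to be at least the mediant.  Hence every load (|P|-1)/d(P) is below 2/λ.
-- If instead d(P)/(|P|-1) ≥ 3λ, comparing P with two-part partitions shows that H[S] is
-- 3λ-edge-connected; then so is its preimage in G, which by maximality lies in a single
-- 3λ-strong component, so S is one vertex of H and P separates no edge.
module Submission where

open import Defs
open import Data.Nat using (ℕ; _*_)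
open import Data.Fin using (Fin)
open import Data.Product using (_×_)
open import Data.Rational using (ℚ; _<_; 1ℚ)
open import Data.Rational as Q using ()

open import Data.Bool using (Bool; true; false; _∧_; not; if_then_else_)
import Data.Bool.Properties as Bool
open import Data.Empty using (⊥-elim)
open import Data.Fin as Fin using (zero; suc; _≟_; punchIn; punchOut; _↑ˡ_; _↑ʳ_; splitAt; join)
import Data.Fin.Properties as Fin
import Data.Integer as ℤ
import Data.Integer.Properties as ℤ
open import Data.Nat as ℕ using (zero; suc; _+_; _∸_; _≤_; z≤n; s≤s)
import Data.Nat.Coprimality as Coprime
import Data.Nat.Properties as ℕ
open import Data.Product using (_,_; proj₁; proj₂; ∃-syntax; map)
import Data.Rational.Properties as ℚ
open import Data.Sum using (inj₁; inj₂)
open import Function using (_∘_; id)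
open import Function.Bundles using (Equivalence)
open import Relation.Binary.PropositionalEquality
open import Relation.Nullary using (¬_; Dec; yes; no)
open import Relation.Nullary.Decidable using (⌊_⌋; isYes≗does; dec-true; dec-false; ⌊⌋-map′; _×-dec_)

open import Algebra.Properties.CommutativeMonoid.Sum ℕ.+-0-commutativeMonoid
  using (sum; sum-cong-≗; sum-replicate-zero; ∑-distrib-+; ∑-comm)
open import Algebra.Properties.Semiring.Sum ℕ.+-*-semiring using (*-distribˡ-sum)
open import Algebra.Properties.CommutativeSemigroup ℕ.*-commutativeSemigroup using (xy∙z≈xz∙y)

private
  variable
    n m : ℕ

indicator : Bool → ℕ
indicator b = if b then 1 else 0

count≡sum : (P : Fin m → Bool) → count P ≡ sum (indicator ∘ P)
count≡sum {zero}  P = refl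
count≡sum {suc m} P = cong (indicator (P zero) +_) (count≡sum (P ∘ suc))

count-cong : {P Q : Fin m → Bool} → P ≗ Q → count P ≡ count Q
count-cong {zero}  P≗Q = refl
count-cong {suc m} P≗Q = cong₂ _+_ (cong indicator (P≗Q zero)) (count-cong (P≗Q ∘ suc))

count-punchIn : (P : Fin (suc m) → Bool) (j : Fin (suc m)) → P j ≡ true →
  count P ≡ suc (count (P ∘ punchIn j))
count-punchIn P zero Pj = cong (λ b → indicator b + count (P ∘ suc)) Pj
count-punchIn {suc m} P (suc j) Pj = begin
  indicator (P zero) + count (P ∘ suc)                        ≡⟨ cong (indicator (P zero) +_) (count-punchIn (P ∘ suc) j Pj) ⟩
  indicator (P zero) + suc (count (P ∘ suc ∘ punchIn j))      ≡⟨ ℕ.+-suc _ _ ⟩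
  suc (count (P ∘ punchIn (suc j)))                           ∎
  where open ≡-Reasoning

count-≤-injection : ∀ {m′} (P : Fin m → Bool) (Q : Fin m′ → Bool)
  (h : ∀ e → P e ≡ true → Fin m′) →
  (∀ e Pe → Q (h e Pe) ≡ true) →
  (∀ e₁ Pe₁ e₂ Pe₂ → h e₁ Pe₁ ≡ h e₂ Pe₂ → e₁ ≡ e₂) →
  count P ≤ count Q
count-≤-injection {zero} P Q h Qh h-inj = z≤n
count-≤-injection {suc m} P Q h Qh h-inj with P zero in P₀
... | false = count-≤-injection (P ∘ suc) Q (h ∘ suc) (Qh ∘ suc)
                (λ e₁ Pe₁ e₂ Pe₂ → Fin.suc-injective ∘ h-inj (suc e₁) Pe₁ (suc e₂) Pe₂)
count-≤-injection {suc m} {zero} P Q h Qh h-inj | true with () ← h zero P₀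
count-≤-injection {suc m} {suc m′} P Q h Qh h-inj | true =
  subst (suc (count (P ∘ suc)) ≤_) (sym (count-punchIn Q j (Qh zero P₀)))
    (s≤s (count-≤-injection (P ∘ suc) (Q ∘ punchIn j) h′ Qh′ h′-inj))
  where
  j = h zero P₀
  j≢h : ∀ e Pe → j ≢ h (suc e) Pe
  j≢h e Pe j≡h with () ← h-inj zero P₀ (suc e) Pe j≡h
  h′ : ∀ e → P (suc e) ≡ true → Fin m′
  h′ e Pe = punchOut (j≢h e Pe)
  Qh′ : ∀ e Pe → Q (punchIn j (h′ e Pe)) ≡ true
  Qh′ e Pe = trans (cong Q (Fin.punchIn-punchOut (j≢h e Pe))) (Qh (suc e) Pe)
  h′-inj : ∀ e₁ Pe₁ e₂ Pe₂ → h′ e₁ Pe₁ ≡ h′ e₂ Pe₂ → e₁ ≡ e₂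
  h′-inj e₁ Pe₁ e₂ Pe₂ =
    Fin.suc-injective ∘ h-inj (suc e₁) Pe₁ (suc e₂) Pe₂ ∘ Fin.punchOut-injective (j≢h e₁ Pe₁) (j≢h e₂ Pe₂)

count-mono : (P Q : Fin m → Bool) → (∀ e → P e ≡ true → Q e ≡ true) → count P ≤ count Q
count-mono P Q P⇒Q = count-≤-injection P Q (λ e _ → e) P⇒Q (λ _ _ _ _ → id)

count-pos : (P : Fin m → Bool) (e : Fin m) → P e ≡ true → 1 ≤ count P
count-pos P e Pe = count-≤-injection {1} (λ _ → true) P (λ _ _ → e) (λ _ _ → Pe) λ { zero _ zero _ _ → refl }

sum-≥ : ∀ {r} c (f : Fin r → ℕ) → (∀ i → c ≤ f i) → r * c ≤ sum f
sum-≥ {zero}  c f c≤f = z≤n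
sum-≥ {suc r} c f c≤f = ℕ.+-mono-≤ (c≤f zero) (sum-≥ c (f ∘ suc) (c≤f ∘ suc))

≟-true : ∀ {r} {x y : Fin r} → x ≡ y → ⌊ x ≟ y ⌋ ≡ true
≟-true {x = x} {y} x≡y = trans (isYes≗does (x ≟ y)) (dec-true (x ≟ y) x≡y)

≟-false : ∀ {r} {x y : Fin r} → x ≢ y → ⌊ x ≟ y ⌋ ≡ false
≟-false {x = x} {y} x≢y = trans (isYes≗does (x ≟ y)) (dec-false (x ≟ y) x≢y)

sum-point : ∀ {r} (x : Fin r) → sum (λ j → indicator ⌊ x ≟ j ⌋) ≡ 1
sum-point {suc r} zero = cong suc (sum-replicate-zero r)
sum-point {suc r} (suc x) = begin
  sum (λ j → indicator ⌊ suc x ≟ suc j ⌋)  ≡⟨ sum-cong-≗ (λ j → cong indicator (⌊⌋-map′ (cong suc) Fin.suc-injective (x ≟ j))) ⟩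
  sum (λ j → indicator ⌊ x ≟ j ⌋)          ≡⟨ sum-point x ⟩
  1                                        ∎
  where open ≡-Reasoning

xor-self : ∀ b → (b xor b) ≡ false
xor-self true  = refl
xor-self false = refl

∑-separates : ∀ {r} (x y : Fin r) →
  sum (λ j → indicator (⌊ x ≟ j ⌋ xor ⌊ y ≟ j ⌋)) ≡ 2 * indicator (not ⌊ x ≟ y ⌋)
∑-separates {r = r} x y with x ≟ y
... | yes refl = trans (sum-cong-≗ {r} (λ j → cong indicator (xor-self ⌊ x ≟ j ⌋))) (sum-replicate-zero r)
... | no x≢y = begin
  sum (λ j → indicator (⌊ x ≟ j ⌋ xor ⌊ y ≟ j ⌋))               ≡⟨ sum-cong-≗ {r} xor-as-+ ⟩
  sum (λ j → indicator ⌊ x ≟ j ⌋ + indicator ⌊ y ≟ j ⌋)          ≡⟨ ∑-distrib-+ {r} (indicator ∘ ⌊_⌋ ∘ (x ≟_)) (indicator ∘ ⌊_⌋ ∘ (y ≟_)) ⟩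
  sum (λ j → indicator ⌊ x ≟ j ⌋) + sum (λ j → indicator ⌊ y ≟ j ⌋) ≡⟨ cong₂ _+_ (sum-point x) (sum-point y) ⟩
  2                                                             ∎
  where
  open ≡-Reasoning
  xor-as-+ : ∀ j → indicator (⌊ x ≟ j ⌋ xor ⌊ y ≟ j ⌋) ≡ indicator ⌊ x ≟ j ⌋ + indicator ⌊ y ≟ j ⌋
  xor-as-+ j with x ≟ j | y ≟ j
  ... | yes refl | yes refl = ⊥-elim (x≢y refl)
  ... | yes _    | no _     = refl
  ... | no _     | yes _    = refl
  ... | no _     | no _     = refl

-- Every edge of G[S] between different parts of q lies on the boundary of exactly two parts.
∑-cutIn-part : ∀ {r} (G : Graph n m) (S : VSet n) (q : Fin n → Fin r) →
  sum (λ j → cutIn G S (part S q j)) ≡ 2 * dP G S q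
∑-cutIn-part {n = n} {m = m} {r = r} G S q = begin
  sum (λ j → cutIn G S (part S q j))                    ≡⟨ sum-cong-≗ {r} (λ j → count≡sum (onBoundary j)) ⟩
  sum (λ j → sum (λ e → boundary j e))                  ≡⟨ ∑-comm {r} {m} boundary ⟩
  sum (λ e → sum (λ j → boundary j e))                  ≡⟨ sum-cong-≗ {m} (λ e → per-edge (S (x e)) (S (y e)) (q (x e)) (q (y e))) ⟩
  sum (λ e → 2 * indicator (crossing e))                ≡⟨ *-distribˡ-sum {m} 2 (indicator ∘ crossing) ⟨
  2 * sum (λ e → indicator (crossing e))                ≡⟨ cong (2 *_) (count≡sum crossing) ⟨
  2 * dP G S q                                          ∎
  where
  open ≡-Reasoning
  x y : Fin m → Fin n
  x e = proj₁ (G e)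
  y e = proj₂ (G e)
  onBoundary : Fin r → Fin m → Bool
  onBoundary j e = inside G S e ∧ (part S q j (x e) xor part S q j (y e))
  boundary : Fin r → Fin m → ℕ
  boundary j = indicator ∘ onBoundary j
  crossing : Fin m → Bool
  crossing e = inside G S e ∧ not ⌊ q (x e) ≟ q (y e) ⌋
  per-edge : ∀ s t (a b : Fin r) →
    sum (λ j → indicator ((s ∧ t) ∧ ((s ∧ ⌊ a ≟ j ⌋) xor (t ∧ ⌊ b ≟ j ⌋)))) ≡ 2 * indicator ((s ∧ t) ∧ not ⌊ a ≟ b ⌋)
  per-edge true  true  a b = ∑-separates a b
  per-edge true  false a b = sum-replicate-zero r
  per-edge false t     a b = sum-replicate-zero r

side : Bool → Fin 2
side true  = zero
side false = suc zero

bipartition : VSet n → Fin n → Fin 2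
bipartition A = side ∘ A

dP-bipartition : (G : Graph n m) (S A : VSet n) → dP G S (bipartition A) ≡ cutIn G S A
dP-bipartition G S A = count-cong λ e → cong (inside G S e ∧_) (separated (A (proj₁ (G e))) (A (proj₂ (G e))))
  where
  separated : ∀ a b → not ⌊ side a ≟ side b ⌋ ≡ (a xor b)
  separated true  true  = refl
  separated true  false = refl
  separated false true  = refl
  separated false false = refl

bipartition-isPartition : {S A : VSet n} → IsCutSet S A → IsPartition S (bipartition A)
bipartition-isPartition (A⊆S , (a , a∈A) , _) zero = a , A⊆S a a∈A , cong side a∈A
bipartition-isPartition (_ , _ , (b , b∈S , b∉A)) (suc zero) = b , b∈S , cong side b∉A

part-isCutSet : ∀ {r} {S : VSet n} {q : Fin n → Fin (2 + r)} → IsPartition S q → ∀ j → IsCutSet S (part S q j)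
part-isCutSet {S = S} {q} isPartition j =
  (λ v → Bool.∧-conicalˡ (S v) _) ,
  (v , cong₂ _∧_ v∈S (≟-true qv≡j)) ,
  (w , w∈S , cong₂ _∧_ w∈S (≟-false (Fin.punchInᵢ≢i j zero ∘ trans (sym qw≡j′))))
  where
  v = proj₁ (isPartition j)
  v∈S = proj₁ (proj₂ (isPartition j))
  qv≡j = proj₂ (proj₂ (isPartition j))
  w = proj₁ (isPartition (punchIn j zero))
  w∈S = proj₁ (proj₂ (isPartition (punchIn j zero)))
  qw≡j′ = proj₂ (proj₂ (isPartition (punchIn j zero)))

minRatio⇒kEdgeConnected : ∀ {r} {G : Graph n m} {S : VSet n} {p : Fin n → Fin r} (k : ℕ) →
  MinRatio G S p → 2 ≤ r → k * (r ∸ 1) ≤ dP G S p → KEdgeConnected G k S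
minRatio⇒kEdgeConnected {r = suc (suc r)} {G = G} {S} {p} k minRatio (s≤s (s≤s _)) k≤ratio A A-cut =
  ℕ.*-cancelʳ-≤ k (cutIn G S A) (suc r) (begin
    k * suc r                          ≤⟨ k≤ratio ⟩
    dP G S p                           ≡⟨ ℕ.*-identityʳ _ ⟨
    dP G S p * 1                       ≤⟨ minRatio 2 (bipartition A) ℕ.≤-refl (bipartition-isPartition A-cut) ⟩
    dP G S (bipartition A) * suc r     ≡⟨ cong (_* suc r) (dP-bipartition G S A) ⟩
    cutIn G S A * suc r                ∎)
  where open ℕ.≤-Reasoning

RatioExceeds : Graph n m → ℕ → ℕ → VSet n → Set
RatioExceeds {n} G a b S = ∀ r (q : Fin n → Fin r) → 2 ≤ r → IsPartition S q → a * (r ∸ 1) ℕ.< b * dP G S q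

kEdgeConnected⇒ratioExceeds : (G : Graph n m) {S : VSet n} {k : ℕ} →
  1 ≤ k → KEdgeConnected G k S → RatioExceeds G k 2 S
kEdgeConnected⇒ratioExceeds G {S} {k} 1≤k k-connected (suc (suc r)) q (s≤s (s≤s _)) isPartition = begin-strict
  k * suc r                           ≡⟨ ℕ.*-comm k (suc r) ⟩
  suc r * k                           <⟨ ℕ.m<n+m _ 1≤k ⟩
  (2 + r) * k                         ≤⟨ sum-≥ k _ (λ j → k-connected _ (part-isCutSet isPartition j)) ⟩
  sum (λ j → cutIn G S (part S q j))  ≡⟨ ∑-cutIn-part G S q ⟩
  2 * dP G S q                        ∎
  where open ℕ.≤-Reasoning

-- Refining one part of a partition

↑ˡ≢↑ʳ : ∀ {a b} (x : Fin a) (y : Fin b) → x ↑ˡ b ≢ a ↑ʳ y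
↑ˡ≢↑ʳ {a} {b} x y eq with () ← trans (sym (Fin.splitAt-↑ˡ a x b)) (trans (cong (splitAt a) eq) (Fin.splitAt-↑ʳ a b y))

-- A vertex of part i gets its label b under the refining partition, placed in the first block;
-- a vertex in another part a keeps a, renumbered into the second block.
module _ {r′ r₀ : ℕ} (i : Fin (suc r₀)) where

  refinedLabel : Fin r′ → (a : Fin (suc r₀)) → Dec (a ≡ i) → Fin (r′ + r₀)
  refinedLabel b a (yes _)  = b ↑ˡ r₀
  refinedLabel b a (no a≢i) = r′ ↑ʳ punchOut (a≢i ∘ sym)

  refinedLabel-inside : ∀ b a (a≟i : Dec (a ≡ i)) → ⌊ a≟i ⌋ ≡ true → refinedLabel b a a≟i ≡ b ↑ˡ r₀
  refinedLabel-inside b a (yes _) _ = refl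

  refinedLabel-outside : ∀ b a k (a≟i : Dec (a ≡ i)) → a ≡ punchIn i k → refinedLabel b a a≟i ≡ r′ ↑ʳ k
  refinedLabel-outside b a k (yes a≡i) a≡ = ⊥-elim (Fin.punchInᵢ≢i i k (trans (sym a≡) a≡i))
  refinedLabel-outside b a k (no _)    a≡ = cong (r′ ↑ʳ_) (trans (Fin.punchOut-cong i a≡) (Fin.punchOut-punchIn i))

  refinedLabel-separates : ∀ b₁ b₂ a₁ a₂ (a₁≟i : Dec (a₁ ≡ i)) (a₂≟i : Dec (a₂ ≡ i)) →
    indicator (not ⌊ refinedLabel b₁ a₁ a₁≟i ≟ refinedLabel b₂ a₂ a₂≟i ⌋) ≡
    indicator (not ⌊ a₁ ≟ a₂ ⌋) + indicator ((⌊ a₁≟i ⌋ ∧ ⌊ a₂≟i ⌋) ∧ not ⌊ b₁ ≟ b₂ ⌋)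
  refinedLabel-separates b₁ b₂ a a (yes refl) (yes refl)
    rewrite ≟-true {x = a} refl
    with b₁ ≟ b₂ | b₁ ↑ˡ r₀ ≟ b₂ ↑ˡ r₀
  ... | yes _ | yes _ = refl
  ... | no _  | no _  = refl
  ... | yes refl | no ne = ⊥-elim (ne refl)
  ... | no ne | yes eq = ⊥-elim (ne (Fin.↑ˡ-injective r₀ b₁ b₂ eq))
  refinedLabel-separates b₁ b₂ a₁ a₂ (yes refl) (no a₂≢i)
    with b₁ ↑ˡ r₀ ≟ r′ ↑ʳ punchOut (a₂≢i ∘ sym) | a₁ ≟ a₂
  ... | yes eq | _      = ⊥-elim (↑ˡ≢↑ʳ b₁ _ eq)
  ... | no _   | yes eq = ⊥-elim (a₂≢i (sym eq))
  ... | no _   | no _   = refl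
  refinedLabel-separates b₁ b₂ a₁ a₂ (no a₁≢i) (yes refl)
    with r′ ↑ʳ punchOut (a₁≢i ∘ sym) ≟ b₂ ↑ˡ r₀ | a₁ ≟ a₂
  ... | yes eq | _      = ⊥-elim (↑ˡ≢↑ʳ b₂ _ (sym eq))
  ... | no _   | yes eq = ⊥-elim (a₁≢i eq)
  ... | no _   | no _   = refl
  refinedLabel-separates b₁ b₂ a₁ a₂ (no a₁≢i) (no a₂≢i)
    with r′ ↑ʳ punchOut (a₁≢i ∘ sym) ≟ r′ ↑ʳ punchOut (a₂≢i ∘ sym) | a₁ ≟ a₂
  ... | yes _  | yes _    = refl
  ... | yes eq | no a₁≢a₂ = ⊥-elim (a₁≢a₂ (Fin.punchOut-injective (a₁≢i ∘ sym) (a₂≢i ∘ sym) (Fin.↑ʳ-injective r′ _ _ eq)))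
  ... | no ne  | yes refl = ⊥-elim (ne refl)
  ... | no _   | no _     = refl

refine : ∀ {r′ r₀} (p : Fin n → Fin (suc r₀)) (i : Fin (suc r₀)) (q : Fin n → Fin r′) → Fin n → Fin (r′ + r₀)
refine p i q v = refinedLabel i (q v) (p v) (p v ≟ i)

indicator-∧-split : ∀ s t (X Y Z a b : Bool) → indicator X ≡ indicator Y + indicator ((a ∧ b) ∧ Z) →
  indicator ((s ∧ t) ∧ X) ≡ indicator ((s ∧ t) ∧ Y) + indicator (((s ∧ a) ∧ (t ∧ b)) ∧ Z)
indicator-∧-split true  true  X Y Z a    b eq = eq
indicator-∧-split true  false X Y Z true b eq = refl
indicator-∧-split true  false X Y Z false b eq = refl
indicator-∧-split false t     X Y Z a    b eq = refl

dP-refine : ∀ {r′ r₀} (G : Graph n m) (S : VSet n) (p : Fin n → Fin (suc r₀)) (i : Fin (suc r₀)) (q : Fin n → Fin r′) →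
  dP G S (refine p i q) ≡ dP G S p + dP G (part S p i) q
dP-refine {n = n} {m = m} G S p i q = begin
  dP G S (refine p i q)                              ≡⟨ count≡sum (separatedBy (refine p i q) S) ⟩
  sum (indicator ∘ separatedBy (refine p i q) S)     ≡⟨ sum-cong-≗ {m} per-edge ⟩
  sum (λ e → indicator (separatedBy p S e) + indicator (separatedBy q (part S p i) e))
    ≡⟨ ∑-distrib-+ {m} (indicator ∘ separatedBy p S) (indicator ∘ separatedBy q (part S p i)) ⟩
  sum (indicator ∘ separatedBy p S) + sum (indicator ∘ separatedBy q (part S p i))
    ≡⟨ cong₂ _+_ (count≡sum (separatedBy p S)) (count≡sum (separatedBy q (part S p i))) ⟨
  dP G S p + dP G (part S p i) q                     ∎
  where
  open ≡-Reasoning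
  separatedBy : ∀ {k} → (Fin n → Fin k) → VSet n → Fin m → Bool
  separatedBy f T e = inside G T e ∧ not ⌊ f (proj₁ (G e)) ≟ f (proj₂ (G e)) ⌋
  per-edge : ∀ e → indicator (separatedBy (refine p i q) S e) ≡
                   indicator (separatedBy p S e) + indicator (separatedBy q (part S p i) e)
  per-edge e = indicator-∧-split (S x) (S y) _ _ _ _ _
    (refinedLabel-separates i (q x) (q y) (p x) (p y) (p x ≟ i) (p y ≟ i))
    where
    x = proj₁ (G e)
    y = proj₂ (G e)

refine-isPartition : ∀ {r′ r₀} {S : VSet n} {p : Fin n → Fin (suc r₀)} {i : Fin (suc r₀)} {q : Fin n → Fin r′} →
  IsPartition S p → IsPartition (part S p i) q → IsPartition S (refine p i q)
refine-isPartition {r′ = r′} {r₀} {S} {p} {i} {q} isPartitionP isPartitionQ l =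
  witness (splitAt r′ l) (Fin.join-splitAt r′ r₀ l)
  where
  witness : ∀ s → join r′ r₀ s ≡ l → ∃[ v ] (v ∈ S × refine p i q v ≡ l)
  witness (inj₁ b) refl with isPartitionQ b
  ... | v , v∈part , refl =
    v , Bool.∧-conicalˡ (S v) _ v∈part , refinedLabel-inside i (q v) (p v) (p v ≟ i) (Bool.∧-conicalʳ (S v) _ v∈part)
  witness (inj₂ a) refl with isPartitionP (punchIn i a)
  ... | v , v∈S , pv≡ = v , v∈S , refinedLabel-outside i (q v) (p v) a (p v ≟ i) pv≡

-- The min-ratio cut process

-- (D + E)/(x + y) is the mediant of D/y ≤ E/x, so it is at most E/x.
<-mediant⇒<-ratio : ∀ a b x y D E → 1 ≤ x → D * x ≤ E * y → a * (x + y) ℕ.< b * (D + E) → a * x ℕ.< b * E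
<-mediant⇒<-ratio a b x@(suc _) y D E _ Dx≤Ey below-mediant = ℕ.≰⇒> λ bE≤ax → ℕ.<⇒≱ below-mediant (begin
  b * (D + E)    ≡⟨ ℕ.*-distribˡ-+ b D E ⟩
  b * D + b * E  ≤⟨ ℕ.+-mono-≤ (bD≤ay bE≤ax) bE≤ax ⟩
  a * y + a * x  ≡⟨ ℕ.+-comm (a * y) (a * x) ⟩
  a * x + a * y  ≡⟨ ℕ.*-distribˡ-+ a x y ⟨
  a * (x + y)    ∎)
  where
  open ℕ.≤-Reasoning
  bD≤ay : b * E ≤ a * x → b * D ≤ a * y
  bD≤ay bE≤ax = ℕ.*-cancelʳ-≤ (b * D) (a * y) x (begin
    b * D * x    ≡⟨ ℕ.*-assoc b D x ⟩
    b * (D * x)  ≤⟨ ℕ.*-monoʳ-≤ b Dx≤Ey ⟩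
    b * (E * y)  ≡⟨ ℕ.*-assoc b E y ⟨
    b * E * y    ≤⟨ ℕ.*-monoˡ-≤ y bE≤ax ⟩
    a * x * y    ≡⟨ xy∙z≈xz∙y a x y ⟩
    a * y * x    ∎)

InheritedByParts : Graph n m → (VSet n → Set) → Set
InheritedByParts {n} G Inv =
  ∀ {S r} (p : Fin n → Fin r) → Inv S → MinRatio G S p → IsPartition S p → ∀ i → Inv (part S p i)

ratioExceeds-part : (G : Graph n m) (a b : ℕ) → InheritedByParts G (RatioExceeds G a b)
ratioExceeds-part G a b {S} {suc r₀} p exceeds minRatio isPartitionP i (suc x) q (s≤s 1≤x) isPartitionQ =
  <-mediant⇒<-ratio a b x r₀ D E 1≤x Dx≤Er₀
    (subst (λ d → a * (x + r₀) ℕ.< b * d) (dP-refine G S p i q) (exceeds _ refined 2≤ refined-isPartition))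
  where
  open ℕ.≤-Reasoning
  D = dP G S p
  E = dP G (part S p i) q
  refined = refine p i q
  refined-isPartition = refine-isPartition isPartitionP isPartitionQ
  2≤ : 2 ≤ suc x + r₀
  2≤ = s≤s (ℕ.≤-trans 1≤x (ℕ.m≤m+n x r₀))
  Dx≤Er₀ : D * x ≤ E * r₀
  Dx≤Er₀ = ℕ.+-cancelˡ-≤ (D * r₀) _ _ (begin
    D * r₀ + D * x       ≡⟨ ℕ.+-comm (D * r₀) (D * x) ⟩
    D * x + D * r₀       ≡⟨ ℕ.*-distribˡ-+ D x r₀ ⟨
    D * (x + r₀)         ≤⟨ minRatio _ refined 2≤ refined-isPartition ⟩
    dP G S refined * r₀  ≡⟨ cong (_* r₀) (dP-refine G S p i q) ⟩
    (D + E) * r₀         ≡⟨ ℕ.*-distribʳ-+ r₀ D E ⟩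
    D * r₀ + E * r₀      ∎)

record SeparatingSplit (G : Graph n m) (Inv : VSet n → Set) (ℓ : Fin m → ℚ) (e : Fin m) : Set where
  field
    S           : VSet n
    r           : ℕ
    p           : Fin n → Fin r
    2≤r         : 2 ≤ r
    isPartition : IsPartition S p
    minRatio    : MinRatio G S p
    load        : ℓ e Q.* ℕtoℚ (dP G S p) ≡ ℕtoℚ (r ∸ 1)
    invariant   : Inv S
    x∈S         : proj₁ (G e) ∈ S
    y∈S         : proj₂ (G e) ∈ S

separatingSplit : {G : Graph n m} {Inv : VSet n → Set} {ℓ : Fin m → ℚ} {S : VSet n} →
  InheritedByParts G Inv → LoadProcess G S ℓ → Inv S →
  ∀ e → proj₁ (G e) ∈ S → proj₂ (G e) ∈ S → proj₁ (G e) ≢ proj₂ (G e) → SeparatingSplit G Inv ℓ e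
separatingSplit inherit (stop trivial) inv e x∈S y∈S x≢y = ⊥-elim (x≢y (trivial _ _ x∈S y∈S))
separatingSplit {G = G} inherit (split {S} r p 2≤r isPartition minRatio loads parts) inv e x∈S y∈S x≢y
  with p (proj₁ (G e)) ≟ p (proj₂ (G e))
... | no px≢py = record
  { S = S ; r = r ; p = p ; 2≤r = 2≤r ; isPartition = isPartition ; minRatio = minRatio
  ; load = loads e (cong₂ _∧_ (cong₂ _∧_ x∈S y∈S) (cong not (≟-false px≢py)))
  ; invariant = inv ; x∈S = x∈S ; y∈S = y∈S }
... | yes px≡py = separatingSplit inherit (parts i) (inherit p inv minRatio isPartition i) e
  (cong₂ _∧_ x∈S (≟-true refl)) (cong₂ _∧_ y∈S (≟-true (sym px≡py))) x≢y
  where i = p (proj₁ (G e))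

-- Cuts and contractions

xor⇒≢ : ∀ {a b} → (a xor b) ≡ true → a ≢ b
xor⇒≢ {a} a⊕b refl with () ← trans (sym a⊕b) (xor-self a)

cutIn-cong : (G : Graph n m) (S : VSet n) {A B : VSet n} → A ≗ B → cutIn G S A ≡ cutIn G S B
cutIn-cong G S A≗B = count-cong λ e → cong₂ (λ a b → inside G S e ∧ (a xor b)) (A≗B (proj₁ (G e))) (A≗B (proj₂ (G e)))

cutIn-restrict : (G : Graph n m) {C T : VSet n} (A : VSet n) → C ⊆ T → cutIn G C (λ v → C v ∧ A v) ≤ cutIn G T A
cutIn-restrict G {C} {T} A C⊆T = count-mono _ _ λ e → restrict (proj₁ (G e)) (proj₂ (G e))
  where
  restrict : ∀ x y → (C x ∧ C y) ∧ ((C x ∧ A x) xor (C y ∧ A y)) ≡ true → (T x ∧ T y) ∧ (A x xor A y) ≡ true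
  restrict x y cut with C x in x∈C | C y in y∈C
  ... | true | true rewrite C⊆T x x∈C | C⊆T y y∈C = cut

reach⇒cutIn-pos : (G : Graph n m) (A : VSet n) {u w : Fin n} → Reach G u w → A u ≡ true → A w ≡ false →
  1 ≤ cutIn G allV A
reach⇒cutIn-pos G A here u∈A u∉A with () ← trans (sym u∈A) u∉A
reach⇒cutIn-pos G A (fwd {v = v} e Ge≡uv rest) u∈A w∉A with A v in Av
... | true  = reach⇒cutIn-pos G A rest Av w∉A
... | false = count-pos _ e crossing
  where
  crossing : (A (proj₁ (G e)) xor A (proj₂ (G e))) ≡ true
  crossing rewrite Ge≡uv | u∈A | Av = refl
reach⇒cutIn-pos G A (bwd {v = v} e Ge≡vu rest) u∈A w∉A with A v in Av
... | true  = reach⇒cutIn-pos G A rest Av w∉A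
... | false = count-pos _ e crossing
  where
  crossing : (A (proj₁ (G e)) xor A (proj₂ (G e))) ≡ true
  crossing rewrite Ge≡vu | u∈A | Av = refl

minCut-pos : {G : Graph n m} {lam : ℕ} → Connected G → IsMinCut G lam → 1 ≤ lam
minCut-pos {G = G} connected ((A , (_ , (a , a∈A) , (b , _ , b∉A)) , cut≡lam) , _) =
  subst (1 ≤_) cut≡lam (reach⇒cutIn-pos G A (connected a b) a∈A b∉A)

module Contraction {n m n′ m′} {G : Graph n m} {k : ℕ} {H : Graph n′ m′} (contraction : IsContraction G k H) where
  open IsContraction contraction

  rep : Fin n′ → Fin n
  rep x = proj₁ (vert-surj x)

  vert-rep : ∀ x → vert (rep x) ≡ x
  vert-rep x = proj₂ (vert-surj x)

  no-loops : ∀ e → proj₁ (H e) ≢ proj₂ (H e)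
  no-loops e loop = Equivalence.from (edge-image (edge e)) (e , refl)
    (trans (sym (cong proj₁ (edge-ends e))) (trans loop (cong proj₂ (edge-ends e))))

  cutIn-vert : (S A : VSet n′) → cutIn G (S ∘ vert) (A ∘ vert) ≡ cutIn H S A
  cutIn-vert S A = ℕ.≤-antisym
    (count-≤-injection _ _ lift lift-crosses lift-injective)
    (count-≤-injection _ _ (λ e _ → edge e) (λ e → subst Crossing (edge-ends e)) (λ e₁ _ e₂ _ → edge-inj e₁ e₂))
    where
    Crossing : Fin n′ × Fin n′ → Set
    Crossing ends = ((S (proj₁ ends) ∧ S (proj₂ ends)) ∧ (A (proj₁ ends) xor A (proj₂ ends))) ≡ true
    surviving : ∀ e → Crossing (map vert vert (G e)) → ∃[ e′ ] (edge e′ ≡ e)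
    surviving e crossing = Equivalence.to (edge-image e) (xor⇒≢ (Bool.∧-conicalʳ _ _ crossing) ∘ cong A)
    lift : ∀ e → Crossing (map vert vert (G e)) → Fin m′
    lift e crossing = proj₁ (surviving e crossing)
    lift-crosses : ∀ e crossing → Crossing (H (lift e crossing))
    lift-crosses e crossing =
      subst Crossing (sym (trans (edge-ends _) (cong (map vert vert ∘ G) (proj₂ (surviving e crossing))))) crossing
    lift-injective : ∀ e₁ c₁ e₂ c₂ → lift e₁ c₁ ≡ lift e₂ c₂ → e₁ ≡ e₂
    lift-injective e₁ c₁ e₂ c₂ same =
      trans (sym (proj₂ (surviving e₁ c₁))) (trans (cong edge same) (proj₂ (surviving e₂ c₂)))

  minCut⇒kEdgeConnected : ∀ {lam} → IsMinCut G lam → KEdgeConnected H lam allV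
  minCut⇒kEdgeConnected (_ , minimal) A (_ , (a , a∈A) , (b , _ , b∉A)) =
    ℕ.≤-trans (minimal (A ∘ vert) A∘vert-cut) (ℕ.≤-reflexive (cutIn-vert allV A))
    where
    A∘vert-cut : IsCutSet allV (A ∘ vert)
    A∘vert-cut = (λ _ _ → refl) , (rep a , trans (cong A (vert-rep a)) a∈A) , (rep b , refl , trans (cong A (vert-rep b)) b∉A)

  component⊆preimage : ∀ {S : VSet n′} {C u} → IsStrongComponent G k C → u ∈ C → vert u ∈ S → C ⊆ (S ∘ vert)
  component⊆preimage {S} {C} {u} component u∈C u∈T v v∈C =
    trans (cong S (Equivalence.from (vert-comp v u) (C , component , v∈C , u∈C))) u∈T

  FiberSplit : VSet n → Set
  FiberSplit A = ∃[ u ] ∃[ w ] (vert u ≡ vert w × A u ≡ true × A w ≡ false)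

  fiberSplit? : ∀ A → Dec (FiberSplit A)
  fiberSplit? A = Fin.any? λ u → Fin.any? λ w → (vert u ≟ vert w) ×-dec (A u Bool.≟ true) ×-dec (A w Bool.≟ false)

  constant-on-fibers : ∀ {A} → ¬ FiberSplit A → ∀ u w → vert u ≡ vert w → A u ≡ A w
  constant-on-fibers {A} ¬split u w same with A u in u∈A | A w in w∈A
  ... | true  | true  = refl
  ... | false | false = refl
  ... | true  | false = ⊥-elim (¬split (u , w , same , u∈A , w∈A))
  ... | false | true  = ⊥-elim (¬split (w , u , sym same , w∈A , u∈A))

  kEdgeConnected-preimage : ∀ {S : VSet n′} → KEdgeConnected H k S → KEdgeConnected G k (S ∘ vert)
  kEdgeConnected-preimage {S} S-connected A (A⊆T , (a , a∈A) , (b , b∈T , b∉A)) with fiberSplit? A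
  ... | yes (u , w , same , u∈A , w∉A) =
    ℕ.≤-trans (proj₁ (proj₂ component) (λ v → C v ∧ A v) C∩A-cut) (cutIn-restrict G A C⊆T)
    where
    shared = Equivalence.to (vert-comp u w) same
    C = proj₁ shared
    component = proj₁ (proj₂ shared)
    u∈C = proj₁ (proj₂ (proj₂ shared))
    w∈C = proj₂ (proj₂ (proj₂ shared))
    C⊆T = component⊆preimage {S} component u∈C (A⊆T u u∈A)
    C∩A-cut : IsCutSet C (λ v → C v ∧ A v)
    C∩A-cut = (λ v → Bool.∧-conicalˡ (C v) _) , (u , cong₂ _∧_ u∈C u∈A) , (w , w∈C , cong₂ _∧_ w∈C w∉A)
  ... | no ¬split = begin
    k                               ≤⟨ S-connected (A ∘ rep) A∘rep-cut ⟩
    cutIn H S (A ∘ rep)             ≡⟨ cutIn-vert S (A ∘ rep) ⟨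
    cutIn G (S ∘ vert) (A ∘ rep ∘ vert) ≡⟨ cutIn-cong G (S ∘ vert) rep-vert ⟩
    cutIn G (S ∘ vert) A            ∎
    where
    open ℕ.≤-Reasoning
    rep-vert : ∀ v → A (rep (vert v)) ≡ A v
    rep-vert v = constant-on-fibers ¬split _ _ (vert-rep (vert v))
    A∘rep-cut : IsCutSet S (A ∘ rep)
    A∘rep-cut = (λ x x∈A → subst (_∈ S) (vert-rep x) (A⊆T (rep x) x∈A)) ,
                (vert a , trans (rep-vert a) a∈A) , (vert b , b∈T , trans (rep-vert b) b∉A)

  -- The preimage of S is k-edge-connected, so by maximality it lies inside one k-strong component.
  kEdgeConnected⇒trivial : ∀ {S : VSet n′} → KEdgeConnected H k S → Trivial S
  kEdgeConnected⇒trivial {S} S-connected x y x∈S y∈S = begin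
    x             ≡⟨ vert-rep x ⟨
    vert (rep x)  ≡⟨ Equivalence.from (vert-comp (rep x) (rep y)) (C , component , x∈C , y∈C) ⟩
    vert (rep y)  ≡⟨ vert-rep y ⟩
    y             ∎
    where
    open ≡-Reasoning
    own = Equivalence.to (vert-comp (rep x) (rep x)) refl
    C = proj₁ own
    component = proj₁ (proj₂ own)
    x∈C = proj₁ (proj₂ (proj₂ own))
    T⊆C = proj₂ (proj₂ component) (S ∘ vert)
      (component⊆preimage {S} component x∈C (subst (_∈ S) (sym (vert-rep x)) x∈S)) (kEdgeConnected-preimage S-connected)
    y∈C = T⊆C (rep y) (subst (_∈ S) (sym (vert-rep y)) y∈S)

ℕtoℚ≡mkℚ : ∀ k → ℕtoℚ k ≡ Q.mkℚ (ℤ.+ k) 0 (Coprime.sym (Coprime.1-coprimeTo k))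
ℕtoℚ≡mkℚ k = ℚ.normalize-coprime _

ℕtoℚ-nonNegative : ∀ k → Q.NonNegative (ℕtoℚ k)
ℕtoℚ-nonNegative k rewrite ℕtoℚ≡mkℚ k = _

ℕtoℚ-mono-< : ∀ {a b} → a ℕ.< b → ℕtoℚ a < ℕtoℚ b
ℕtoℚ-mono-< {a} {b} a<b rewrite ℕtoℚ≡mkℚ a | ℕtoℚ≡mkℚ b =
  Q.*<* (subst₂ ℤ._<_ (sym (ℤ.*-identityʳ (ℤ.+ a))) (sym (ℤ.*-identityʳ (ℤ.+ b))) (ℤ.+<+ a<b))

ℕtoℚ-* : ∀ a b → ℕtoℚ a Q.* ℕtoℚ b ≡ ℕtoℚ (a * b)
ℕtoℚ-* a b rewrite ℕtoℚ≡mkℚ a | ℕtoℚ≡mkℚ b = cong (Q._/ 1) (sym (ℤ.pos-* a b))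

scaled-load : ∀ {ℓ d r} a → ℓ Q.* ℕtoℚ d ≡ ℕtoℚ r → ℕtoℚ a Q.* ℓ Q.* ℕtoℚ d ≡ ℕtoℚ (a * r)
scaled-load {ℓ} {d} {r} a load = begin
  ℕtoℚ a Q.* ℓ Q.* ℕtoℚ d    ≡⟨ ℚ.*-assoc (ℕtoℚ a) ℓ (ℕtoℚ d) ⟩
  ℕtoℚ a Q.* (ℓ Q.* ℕtoℚ d)  ≡⟨ cong (ℕtoℚ a Q.*_) load ⟩
  ℕtoℚ a Q.* ℕtoℚ r          ≡⟨ ℕtoℚ-* a r ⟩
  ℕtoℚ (a * r)               ∎
  where open ≡-Reasoning

<-scaled-load : ∀ {ℓ d r} a b → ℓ Q.* ℕtoℚ d ≡ ℕtoℚ r → b * d ℕ.< a * r → ℕtoℚ b < ℕtoℚ a Q.* ℓ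
<-scaled-load {ℓ} {d} {r} a b load bd<ar = ℚ.*-cancelʳ-<-nonNeg (ℕtoℚ d) {{ℕtoℚ-nonNegative d}}
  (subst₂ _<_ (sym (ℕtoℚ-* b d)) (sym (scaled-load {ℓ} {d} {r} a load)) (ℕtoℚ-mono-< bd<ar))

scaled-load-< : ∀ {ℓ d r} a b → ℓ Q.* ℕtoℚ d ≡ ℕtoℚ r → a * r ℕ.< b * d → ℕtoℚ a Q.* ℓ < ℕtoℚ b
scaled-load-< {ℓ} {d} {r} a b load ar<bd = ℚ.*-cancelʳ-<-nonNeg (ℕtoℚ d) {{ℕtoℚ-nonNegative d}}
  (subst₂ _<_ (sym (scaled-load {ℓ} {d} {r} a load)) (sym (ℕtoℚ-* b d)) (ℕtoℚ-mono-< ar<bd))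

lemma3p10 : ∀ {n m} (G : Graph n m) (lam : ℕ) → Connected G → IsMinCut G lam →
    ∀ {n' m'} (H : Graph n' m') → IsContraction G (3 * lam) H →
    (ℓ : Fin m' → ℚ) → IdealLoads H ℓ →
    ∀ (e : Fin m') → (1ℚ < ℕtoℚ (3 * lam) Q.* ℓ e) × (ℕtoℚ lam Q.* ℓ e < ℕtoℚ 2)
lemma3p10 G lam connected minCut H contraction ℓ idealLoads e =
  <-scaled-load {d = dP H S p} {r ∸ 1} (3 * lam) 1 load lower , scaled-load-< {d = dP H S p} {r ∸ 1} lam 2 load upper
  where
  open Contraction contraction
  separation : SeparatingSplit H (RatioExceeds H lam 2) ℓ e
  separation = separatingSplit (ratioExceeds-part H lam 2) idealLoads
    (kEdgeConnected⇒ratioExceeds H (minCut-pos connected minCut) (minCut⇒kEdgeConnected minCut))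
    e refl refl (no-loops e)
  open SeparatingSplit separation
  upper : lam * (r ∸ 1) ℕ.< 2 * dP H S p
  upper = invariant r p 2≤r isPartition
  lower : 1 * dP H S p ℕ.< 3 * lam * (r ∸ 1)
  lower = ℕ.≰⇒> λ dense → no-loops e (kEdgeConnected⇒trivial
    (minRatio⇒kEdgeConnected {G = H} {p = p} (3 * lam) minRatio 2≤r (ℕ.≤-trans dense (ℕ.≤-reflexive (ℕ.*-identityˡ _))))
    _ _ x∈S y∈S)
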